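{- Let $g\in\mathbb{N}$ with $g>2$ and let $n\in\mathbb{N}$ with $2\le n\le g$. Let $S=\{0\}\cup\{g,g+1,\ldots,g+n-2\}\cup\{x\in\mathbb{N}\mid x\ge g+n\}$. Then $S$ is a special numerical semigroup with $\operatorname{F}(S)=g+n-1$, $\operatorname{g}(S)=g$ and $\operatorname{n}(S)=n$. Furthermore: (1) if $n=g$ or $n=g-1$, then $S$ is irreducible; (2) if $3\le n<g-1$, then $S$ is not irreducible and $\operatorname{e}(S)=g-1$; (3) if $g>3$ and $n=2$, then $S$ is not irreducible and $\operatorname{e}(S)=g$.
   Context: $\mathbb{N}=\{0,1,2,\ldots\}$. A numerical semigroup is a submonoid $S$ of $(\mathbb{N},+)$ with $\mathbb{N}\setminus S$ finite. Notation: $\operatorname{H}(S)=\mathbb{N}\setminus S$ (gaps); $\operatorname{g}(S)=|\operatorname{H}(S)|$ (genus); $\operatorname{F}(S)=\max\operatorname{H}(S)$ (Frobenius number, with $\operatorname{F}(\mathbb{N})=-1$); $\operatorname{m}(S)=\min(S\setminus\{0\})$ (multiplicity); $\operatorname{n}(S)=|\{s\in S\mid s<\operatorname{F}(S)\}|$ (with $\operatorname{n}(\mathbb{N})=1$); $\operatorname{e}(S)$ is the cardinality of the unique minimal generating set of $S$ (embedding dimension). The set of special gaps is $\operatorname{SG}(S)=\{h\in\operatorname{H}(S)\mid 2h\in S \text{ and } h+s\in S \text{ for all } s\in S\setminus\{0\}\}$. $S$ is irreducible if it cannot be written as the intersection of two numerical semigroups properly containing $S$. $S$ is called special if there is no $h\in\operatorname{SG}(S)\setminus\{\operatorname{F}(S)\}$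 with $h>\operatorname{m}(S)$. -}

module Defs where

open import Level using (Level; suc; zero)
open import Data.Nat using (ℕ; _+_; _∸_; _≤_; _<_; _*_)
open import Data.Product using (Σ; _×_; ∃-syntax)
open import Data.Sum using (_⊎_)
open import Data.List using (List; length)
open import Data.List.Membership.Propositional using (_∈_)
open import Data.List.Relation.Unary.Unique.Propositional using (Unique)
open import Relation.Binary.PropositionalEquality using (_≡_)
open import Relation.Nullary using (¬_)

Subset : Set₁
Subset = ℕ → Set

_⊆_ : Subset → Subset → Set
A ⊆ B = ∀ x → A x → B x

_⊊_ : Subset → Subset → Set
A ⊊ B = A ⊆ B × (∃[ x ] (B x × ¬ A x))

IsCard : Subset → ℕ → Set
IsCard P k = ∃[ xs ] (Unique xs × (∀ x → x ∈ xs → P x) × (∀ x → P x → x ∈ xs) × length xs ≡ k)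

record NumericalSemigroup (S : Subset) : Set where
  field
    zero∈ : S 0
    closed : ∀ x y → S x → S y → S (x + y)
    cofinite : ∃[ b ] (∀ x → b ≤ x → S x)

Gaps : Subset → Subset
Gaps S x = ¬ S x

HasGenus : Subset → ℕ → Set
HasGenus S k = IsCard (Gaps S) k

IsFrobenius : Subset → ℕ → Set
IsFrobenius S f = Gaps S f × (∀ x → f < x → S x)

IsMultiplicity : Subset → ℕ → Set
IsMultiplicity S m = S m × ¬ m ≡ 0 × (∀ s → S s → ¬ s ≡ 0 → m ≤ s)

HasN : Subset → ℕ → Set
HasN S k = ∀ f → IsFrobenius S f → IsCard (λ x → S x × x < f) k

data ⟨_⟩ (G : Subset) : Subset where
  gen-zero : ⟨ G ⟩ 0
  gen-add  : ∀ {a x} → G a → ⟨ G ⟩ x → ⟨ G ⟩ (a + x)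

Generates : Subset → Subset → Set
Generates G S = G ⊆ S × S ⊆ ⟨ G ⟩

MinimalGenerating : Subset → Subset → Set₁
MinimalGenerating G S = Generates G S × (∀ (G' : Subset) → G' ⊆ G → Generates G' S → G ⊆ G')

-- e(S) = k : the (unique) minimal generating set of S has cardinality k
HasEmbDim : Subset → ℕ → Set₁
HasEmbDim S k = ∃[ G ] (MinimalGenerating G S × IsCard G k)

Irreducible : Subset → Set₁
Irreducible S = ¬ (∃[ T₁ ] ∃[ T₂ ] (NumericalSemigroup T₁ × NumericalSemigroup T₂
                  × S ⊊ T₁ × S ⊊ T₂
                  × (∀ x → S x → T₁ x × T₂ x) × (∀ x → T₁ x → T₂ x → S x)))

IsSpecialGap : Subset → ℕ → Set
IsSpecialGap S h = Gaps S h × S (2 * h) × (∀ s → S s → ¬ s ≡ 0 → S (h + s))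

Special : Subset → Set
Special S = ∀ f m → IsFrobenius S f → IsMultiplicity S m →
            ∀ h → IsSpecialGap S h → m < h → h ≡ f

Sgn : ℕ → ℕ → Subset
Sgn g n x = x ≡ 0 ⊎ (g ≤ x × x ≤ g + n ∸ 2) ⊎ g + n ≤ x

{-# OPTIONS --safe #-}
-- Every nonzero element of S is at least g, and a sum of two of them is at least 2g > F = g + n − 1;
-- this gives closure, the gaps 1, …, g − 1, F, and specialness. A numerical semigroup T ⊋ S contains a
-- gap x; if x ≠ F then x < g, and for n ≥ g − 1 either F − x ∈ S or F = 2x, so F ∈ T and S is
-- irreducible. For n < g − 1 both g − 1 and F are special gaps, and S = (S ∪ {g − 1}) ∩ (S ∪ {F}).
-- The minimal generating set consists of the indecomposable elements: the nonzero elements of S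
-- below 2g, together with g + F exactly when n = 2 (otherwise g + F = (g + 1) + (F − 1)).
module Submission where

open import Defs
open import Function using (_∘_)
open import Data.Nat using (ℕ; zero; suc; _+_; _∸_; _≤_; _<_; z≤n; s≤s; _<?_; _≟_)
open import Data.Nat.Properties
open import Data.Nat.Induction using (<-rec)
open import Data.Product using (_×_; _,_; proj₁; ∃-syntax)
open import Data.Sum using (_⊎_; inj₁; inj₂; [_,_])
open import Data.Empty using (⊥-elim)
open import Data.List using ([]; _∷_; _++_; applyUpTo)
open import Data.List.Properties using (length-++; length-applyUpTo)
open import Data.List.Membership.Propositional using (_∈_)
open import Data.List.Membership.Propositional.Properties using (∈-++⁺ˡ; ∈-++⁺ʳ; ∈-++⁻; ∈-applyUpTo⁺; ∈-applyUpTo⁻)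
open import Data.List.Relation.Unary.All using ([])
open import Data.List.Relation.Unary.Any using (here)
open import Data.List.Relation.Unary.AllPairs using ([]; _∷_)
open import Data.List.Relation.Unary.Unique.Propositional.Properties using (++⁺; applyUpTo⁺₁)
open import Relation.Binary using (tri<; tri≈; tri>)
open import Relation.Binary.PropositionalEquality using (_≡_; _≢_; refl; sym; trans; cong; subst; module ≡-Reasoning)
open import Relation.Nullary using (¬_; yes; no)

IsCard-resp : {P Q : Subset} {k : ℕ} → (∀ x → P x → Q x) → (∀ x → Q x → P x) → IsCard P k → IsCard Q k
IsCard-resp P⊆Q Q⊆P (xs , unique , sound , complete , len) =
  xs , unique , (λ x → P⊆Q x ∘ sound x) , (λ x → complete x ∘ Q⊆P x) , len

IsCard-singleton : ∀ v → IsCard (_≡ v) 1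
IsCard-singleton v = v ∷ [] , [] ∷ [] , (λ { _ (here refl) → refl }) , (λ _ → here) , refl

IsCard-⊎ : {P Q : Subset} {k l : ℕ} → (∀ x → P x → ¬ Q x) →
           IsCard P k → IsCard Q l → IsCard (λ x → P x ⊎ Q x) (k + l)
IsCard-⊎ disjoint (xs , uxs , sxs , cxs , refl) (ys , uys , sys , cys , refl) =
  xs ++ ys , ++⁺ uxs uys (λ (p , q) → disjoint _ (sxs _ p) (sys _ q)) ,
  (λ x → [ inj₁ ∘ sxs x , inj₂ ∘ sys x ] ∘ ∈-++⁻ xs) ,
  (λ x → [ ∈-++⁺ˡ ∘ cxs x , ∈-++⁺ʳ xs ∘ cys x ]) ,
  length-++ xs

IsCard-interval : ∀ a k → IsCard (λ x → a ≤ x × x < a + k) k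
IsCard-interval a k =
  applyUpTo (a +_) k , applyUpTo⁺₁ (a +_) k (λ i<j _ → <⇒≢ (+-monoʳ-< a i<j)) ,
  sound , complete , length-applyUpTo (a +_) k
  where
  sound : ∀ x → x ∈ applyUpTo (a +_) k → a ≤ x × x < a + k
  sound x x∈ with i , i<k , refl ← ∈-applyUpTo⁻ (a +_) x∈ = m≤m+n a i , +-monoʳ-< a i<k
  complete : ∀ x → a ≤ x × x < a + k → x ∈ applyUpTo (a +_) k
  complete x (a≤x , x<a+k) =
    subst (_∈ applyUpTo (a +_) k) (m+[n∸m]≡n a≤x)
      (∈-applyUpTo⁺ (a +_) (subst (x ∸ a <_) (m+n∸m≡n a k) (∸-monoˡ-< x<a+k a≤x)))

⟨⟩-single : {G : Subset} {x : ℕ} → G x → ⟨ G ⟩ x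
⟨⟩-single {G} {x} gx = subst ⟨ G ⟩ (+-identityʳ x) (gen-add gx gen-zero)

⟨⟩-+ : {G : Subset} {x y : ℕ} → ⟨ G ⟩ x → ⟨ G ⟩ y → ⟨ G ⟩ (x + y)
⟨⟩-+ gen-zero dy = dy
⟨⟩-+ {G} {y = y} (gen-add {b} {x} gb dx) dy = subst ⟨ G ⟩ (sym (+-assoc b x y)) (gen-add gb (⟨⟩-+ dx dy))

⟨⟩⊆ : {G S : Subset} → NumericalSemigroup S → G ⊆ S → ⟨ G ⟩ ⊆ S
⟨⟩⊆ ns G⊆S _ gen-zero = NumericalSemigroup.zero∈ ns
⟨⟩⊆ ns G⊆S _ (gen-add {b} {x} gb dx) = NumericalSemigroup.closed ns b x (G⊆S b gb) (⟨⟩⊆ ns G⊆S x dx)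

Decomposable : Subset → Subset
Decomposable S x = ∃[ b ] ∃[ y ] (S b × S y × 0 < b × 0 < y × b + y ≡ x)

Indecomposable : Subset → Subset
Indecomposable S x = S x × 0 < x × ¬ Decomposable S x

Indecomposable⊆generators : {S G : Subset} → NumericalSemigroup S → Generates G S → Indecomposable S ⊆ G
Indecomposable⊆generators {S} {G} ns (G⊆S , S⊆⟨G⟩) x ind = go (S⊆⟨G⟩ x (proj₁ ind)) ind
  where
  go : ∀ {x} → ⟨ G ⟩ x → Indecomposable S x → G x
  go gen-zero (_ , () , _)
  go (gen-add {zero} _ dx) ind = go dx ind
  go (gen-add {suc b} {zero} gb _) _ = subst G (sym (+-identityʳ (suc b))) gb
  go (gen-add {suc b} {suc y} gb dy) (_ , _ , ¬decomposable) =
    ⊥-elim (¬decomposable (suc b , suc y , G⊆S _ gb , ⟨⟩⊆ ns G⊆S _ dy , s≤s z≤n , s≤s z≤n , refl))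

-- Classically every S is trichotomous; constructively this must be supplied.
Trichotomous : Subset → Set
Trichotomous S = ∀ x → S x → x ≡ 0 ⊎ Indecomposable S x ⊎ Decomposable S x

Indecomposable-generates : {S : Subset} → Trichotomous S → S ⊆ ⟨ Indecomposable S ⟩
Indecomposable-generates {S} trichotomy = <-rec (λ x → S x → ⟨ Indecomposable S ⟩ x) step
  where
  step : ∀ x → (∀ {y} → y < x → S y → ⟨ Indecomposable S ⟩ y) → S x → ⟨ Indecomposable S ⟩ x
  step x rec sx with trichotomy x sx
  ... | inj₁ refl = gen-zero
  ... | inj₂ (inj₁ ind) = ⟨⟩-single ind
  ... | inj₂ (inj₂ (b , y , sb , sy , 0<b , 0<y , refl)) = ⟨⟩-+ (rec (m<m+n b 0<y) sb) (rec (m<n+m y 0<b) sy)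

HasEmbDim-Indecomposable : {S : Subset} {k : ℕ} → NumericalSemigroup S → Trichotomous S →
                           IsCard (Indecomposable S) k → HasEmbDim S k
HasEmbDim-Indecomposable {S} ns trichotomy card =
  Indecomposable S ,
  (((λ _ → proj₁) , Indecomposable-generates trichotomy) ,
   (λ _ _ generates → Indecomposable⊆generators ns generates)) ,
  card

adjoin : Subset → ℕ → Subset
adjoin S h x = S x ⊎ x ≡ h

adjoin-specialGap : {S : Subset} {h : ℕ} → NumericalSemigroup S → IsSpecialGap S h → NumericalSemigroup (adjoin S h)
adjoin-specialGap {S} {h} ns (_ , 2h∈S , h+S⊆S) = record
  { zero∈ = inj₁ zero∈
  ; closed = closed′
  ; cofinite = let (b , above) = cofinite in b , λ x b≤x → inj₁ (above x b≤x)
  }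
  where
  open NumericalSemigroup ns
  closed′ : ∀ x y → adjoin S h x → adjoin S h y → adjoin S h (x + y)
  closed′ x y (inj₁ sx) (inj₁ sy) = inj₁ (closed x y sx sy)
  closed′ zero _ (inj₁ _) (inj₂ refl) = inj₂ refl
  closed′ (suc x) _ (inj₁ sx) (inj₂ refl) = inj₁ (subst S (+-comm h (suc x)) (h+S⊆S (suc x) sx λ ()))
  closed′ _ zero (inj₂ refl) (inj₁ _) = inj₂ (+-identityʳ h)
  closed′ _ (suc y) (inj₂ refl) (inj₁ sy) = inj₁ (h+S⊆S (suc y) sy λ ())
  closed′ _ _ (inj₂ refl) (inj₂ refl) = inj₁ (subst S (cong (h +_) (+-identityʳ h)) 2h∈S)

specialGaps⇒¬Irreducible : {S : Subset} {h₁ h₂ : ℕ} → NumericalSemigroup S →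
                           IsSpecialGap S h₁ → IsSpecialGap S h₂ → h₁ ≢ h₂ → ¬ Irreducible S
specialGaps⇒¬Irreducible {S} {h₁} {h₂} ns sg₁ sg₂ h₁≢h₂ irreducible =
  irreducible (adjoin S h₁ , adjoin S h₂ , adjoin-specialGap ns sg₁ , adjoin-specialGap ns sg₂ ,
               ((λ _ → inj₁) , h₁ , inj₂ refl , proj₁ sg₁) , ((λ _ → inj₁) , h₂ , inj₂ refl , proj₁ sg₂) ,
               (λ _ s → inj₁ s , inj₁ s) , meet)
  where
  meet : ∀ x → adjoin S h₁ x → adjoin S h₂ x → S x
  meet _ (inj₁ s) _ = s
  meet _ (inj₂ _) (inj₁ s) = s
  meet _ (inj₂ refl) (inj₂ refl) = ⊥-elim (h₁≢h₂ refl)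

gapInEveryOversemigroup⇒Irreducible : {S : Subset} {f : ℕ} → Gaps S f →
  (∀ T → NumericalSemigroup T → S ⊊ T → T f) → Irreducible S
gapInEveryOversemigroup⇒Irreducible gap forced (T₁ , T₂ , ns₁ , ns₂ , S⊊T₁ , S⊊T₂ , _ , T₁∩T₂⊆S) =
  gap (T₁∩T₂⊆S _ (forced T₁ ns₁ S⊊T₁) (forced T₂ ns₂ S⊊T₂))

-- g = 3 + a and n = 1 + k, so that Sgn g n computes: g + n ∸ 2 reduces to 1 + (a + n) and F to 2 + (a + n).
module Sgn-structure (a k : ℕ) (1≤k : 1 ≤ k) (n≤g : suc k ≤ 3 + a) where

  g n F : ℕ
  g = 3 + a
  n = suc k
  F = g + n ∸ 1

  S : Subset
  S = Sgn g n

  0<g : 0 < g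
  0<g = s≤s z≤n

  g<F : g < F
  g<F = s≤s (s≤s (subst (_≤ a + n) (+-comm a 2) (+-monoʳ-≤ a (s≤s 1≤k))))

  F<g+g : F < g + g
  F<g+g = s≤s (s≤s (s≤s (+-monoʳ-≤ a n≤g)))

  g+k≡F : g + k ≡ F
  g+k≡F = cong (suc ∘ suc) (sym (+-suc a k))

  S-elim : ∀ {x} → S x → x ≡ 0 ⊎ g ≤ x
  S-elim (inj₁ x≡0) = inj₁ x≡0
  S-elim (inj₂ (inj₁ (g≤x , _))) = inj₂ g≤x
  S-elim (inj₂ (inj₂ F<x)) = inj₂ (≤-trans (<⇒≤ g<F) (<⇒≤ F<x))

  S-intro : ∀ {x} → g ≤ x → x ≢ F → S x
  S-intro {x} g≤x x≢F with <-cmp x F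
  ... | tri< x<F _ _ = inj₂ (inj₁ (g≤x , ≤-pred x<F))
  ... | tri≈ _ x≡F _ = ⊥-elim (x≢F x≡F)
  ... | tri> _ _ F<x = inj₂ (inj₂ F<x)

  F∉S : ¬ S F
  F∉S (inj₁ ())
  F∉S (inj₂ (inj₁ (_ , F≤F∸1))) = 1+n≰n F≤F∸1
  F∉S (inj₂ (inj₂ F<F)) = 1+n≰n F<F

  small∉S : ∀ {x} → 0 < x → x < g → ¬ S x
  small∉S 0<x x<g x∈S with S-elim x∈S
  ... | inj₁ refl = 1+n≰n 0<x
  ... | inj₂ g≤x = <⇒≱ x<g g≤x

  gap-cases : ∀ {x} → ¬ S x → (0 < x × x < g) ⊎ x ≡ F
  gap-cases {zero} x∉S = ⊥-elim (x∉S (inj₁ refl))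
  gap-cases {suc x} x∉S with suc x <? g
  ... | yes x<g = inj₁ (s≤s z≤n , x<g)
  ... | no x≮g with suc x ≟ F
  ...   | yes x≡F = inj₂ x≡F
  ...   | no x≢F = ⊥-elim (x∉S (S-intro (≮⇒≥ x≮g) x≢F))

  numericalSemigroup : NumericalSemigroup S
  numericalSemigroup = record { zero∈ = inj₁ refl ; closed = closed ; cofinite = suc F , λ _ → inj₂ ∘ inj₂ }
    where
    closed : ∀ x y → S x → S y → S (x + y)
    closed x y x∈S y∈S with S-elim x∈S | S-elim y∈S
    ... | inj₁ refl | _ = y∈S
    ... | inj₂ _ | inj₁ refl = subst S (sym (+-identityʳ x)) x∈S
    ... | inj₂ g≤x | inj₂ g≤y = inj₂ (inj₂ (≤-trans F<g+g (+-mono-≤ g≤x g≤y)))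

  isFrobenius : IsFrobenius S F
  isFrobenius = F∉S , λ _ → inj₂ ∘ inj₂

  Frobenius-unique : ∀ {f} → IsFrobenius S f → f ≡ F
  Frobenius-unique (f∉S , above) with gap-cases f∉S
  ... | inj₁ (_ , f<g) = ⊥-elim (F∉S (above F (<-trans f<g g<F)))
  ... | inj₂ f≡F = f≡F

  special : Special S
  special f m isF (m∈S , m≢0 , _) h (h∉S , _ , _) m<h with S-elim m∈S | gap-cases h∉S
  ... | inj₁ m≡0 | _ = ⊥-elim (m≢0 m≡0)
  ... | inj₂ g≤m | inj₁ (_ , h<g) = ⊥-elim (<-irrefl refl (<-trans (≤-<-trans g≤m m<h) h<g))
  ... | inj₂ _ | inj₂ h≡F = trans h≡F (sym (Frobenius-unique isF))

  genus : HasGenus S g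
  genus = subst (IsCard (Gaps S)) (+-comm (2 + a) 1)
            (IsCard-resp from (λ _ → gap-cases) (IsCard-⊎ disjoint (IsCard-interval 1 (2 + a)) (IsCard-singleton F)))
    where
    from : ∀ x → (0 < x × x < g) ⊎ x ≡ F → Gaps S x
    from _ (inj₁ (0<x , x<g)) = small∉S 0<x x<g
    from _ (inj₂ refl) = F∉S
    disjoint : ∀ x → 0 < x × x < g → x ≢ F
    disjoint _ (_ , x<g) refl = <-asym x<g g<F

  hasN : HasN S n
  hasN f isF rewrite Frobenius-unique isF =
    IsCard-resp from to (IsCard-⊎ disjoint (IsCard-singleton 0) (IsCard-interval g k))
    where
    from : ∀ x → x ≡ 0 ⊎ (g ≤ x × x < g + k) → S x × x < F
    from _ (inj₁ refl) = inj₁ refl , s≤s z≤n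
    from x (inj₂ (g≤x , x<g+k)) = let x<F = subst (x <_) g+k≡F x<g+k in inj₂ (inj₁ (g≤x , ≤-pred x<F)) , x<F
    to : ∀ x → S x × x < F → x ≡ 0 ⊎ (g ≤ x × x < g + k)
    to x (x∈S , x<F) with S-elim x∈S
    ... | inj₁ x≡0 = inj₁ x≡0
    ... | inj₂ g≤x = inj₂ (g≤x , subst (x <_) (sym g+k≡F) x<F)
    disjoint : ∀ x → x ≡ 0 → ¬ (g ≤ x × x < g + k)
    disjoint _ refl (() , _)

  x<n⇒x+g≤F : ∀ {x} → x < n → x + g ≤ F
  x<n⇒x+g≤F {x} x<n = subst (x + g ≤_) (trans (+-comm k g) g+k≡F) (+-monoˡ-≤ g (≤-pred x<n))

  module _ {T : Subset} (nsT : NumericalSemigroup T) (S⊆T : S ⊆ T) where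
    open NumericalSemigroup nsT using (closed)

    F∈T-via-complement : ∀ {x} → T x → 0 < x → x + g ≤ F → T F
    F∈T-via-complement {x} x∈T 0<x x+g≤F =
      subst T (m+[n∸m]≡n x≤F) (closed x (F ∸ x) x∈T (S⊆T _ (S-intro g≤F∸x F∸x≢F)))
      where
      x≤F : x ≤ F
      x≤F = m+n≤o⇒m≤o x x+g≤F
      g≤F∸x : g ≤ F ∸ x
      g≤F∸x = m+n≤o⇒m≤o∸n g (subst (_≤ F) (+-comm x g) x+g≤F)
      F∸x≢F : F ∸ x ≢ F
      F∸x≢F F∸x≡F = <-irrefl (sym (trans (cong (x +_) (sym F∸x≡F)) (m+[n∸m]≡n x≤F))) (m<n+m F 0<x)

  F∈oversemigroup : n ≡ g ⊎ n ≡ g ∸ 1 → ∀ T → NumericalSemigroup T → S ⊊ T → T F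
  F∈oversemigroup n≈g T nsT (S⊆T , x , x∈T , x∉S) with gap-cases x∉S
  ... | inj₂ refl = x∈T
  ... | inj₁ (0<x , x<g) with n≈g
  ...   | inj₁ n≡g = F∈T-via-complement nsT S⊆T x∈T 0<x (x<n⇒x+g≤F (subst (x <_) (sym n≡g) x<g))
  ...   | inj₂ n≡g∸1 with m≤n⇒m<n∨m≡n (≤-pred x<g)
  ...     | inj₁ x<g∸1 = F∈T-via-complement nsT S⊆T x∈T 0<x (x<n⇒x+g≤F (subst (x <_) (sym n≡g∸1) x<g∸1))
  -- here x = g ∸ 1 = n, so F = x + x
  ...     | inj₂ refl = subst T (cong (λ m → 2 + (a + m)) (sym n≡g∸1)) (NumericalSemigroup.closed nsT x x x∈T x∈T)

  irreducible : n ≡ g ⊎ n ≡ g ∸ 1 → Irreducible S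
  irreducible n≈g = gapInEveryOversemigroup⇒Irreducible F∉S (F∈oversemigroup n≈g)

  specialGap : ∀ {h} → ¬ S h → n ≤ h → F < h + h → IsSpecialGap S h
  specialGap {h} h∉S n≤h F<h+h = h∉S , inj₂ (inj₂ (subst (F <_) (cong (h +_) (sym (+-identityʳ h))) F<h+h)) , h+S⊆S
    where
    h+S⊆S : ∀ s → S s → s ≢ 0 → S (h + s)
    h+S⊆S s s∈S s≢0 with S-elim s∈S
    ... | inj₁ s≡0 = ⊥-elim (s≢0 s≡0)
    ... | inj₂ g≤s = inj₂ (inj₂ (subst (_≤ h + s) (+-comm n g) (+-mono-≤ n≤h g≤s)))

  ¬irreducible : n < g ∸ 1 → ¬ Irreducible S
  ¬irreducible n<g∸1 = specialGaps⇒¬Irreducible numericalSemigroup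
    (specialGap F∉S n≤F (m<m+n F (<-trans 0<g g<F)))
    (specialGap (small∉S (s≤s z≤n) ≤-refl) (<⇒≤ n<g∸1) F<g∸1+g∸1)
    (>⇒≢ (<-trans (n<1+n (2 + a)) g<F))
    where
    n≤F : n ≤ F
    n≤F = ≤-trans (m≤n+m n a) (≤-trans (n≤1+n _) (n≤1+n _))
    F<g∸1+g∸1 : F < (2 + a) + (2 + a)
    F<g∸1+g∸1 = s≤s (s≤s (subst (_≤ a + (2 + a)) (+-suc a n) (+-monoʳ-≤ a n<g∸1)))

  nonzero⇒g≤ : ∀ {x} → S x → 0 < x → g ≤ x
  nonzero⇒g≤ x∈S 0<x with S-elim x∈S
  ... | inj₁ refl = ⊥-elim (1+n≰n 0<x)
  ... | inj₂ g≤x = g≤x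

  Decomposable⇒g+g≤ : ∀ {x} → Decomposable S x → g + g ≤ x
  Decomposable⇒g+g≤ (_ , _ , b∈S , y∈S , 0<b , 0<y , refl) = +-mono-≤ (nonzero⇒g≤ b∈S 0<b) (nonzero⇒g≤ y∈S 0<y)

  Indecomposable-<g+g : ∀ {x} → S x → 0 < x → x < g + g → Indecomposable S x
  Indecomposable-<g+g x∈S 0<x x<g+g = x∈S , 0<x , <⇒≱ x<g+g ∘ Decomposable⇒g+g≤

  Decomposable-≥g+g : ∀ {x} → S x → g + g ≤ x → x ≢ g + F → Decomposable S x
  Decomposable-≥g+g {x} _ g+g≤x x≢g+F =
    g , x ∸ g , S-intro ≤-refl (<⇒≢ g<F) , S-intro g≤x∸g x∸g≢F , 0<g , <-≤-trans 0<g g≤x∸g , m+[n∸m]≡n g≤x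
    where
    g≤x : g ≤ x
    g≤x = m+n≤o⇒m≤o g g+g≤x
    g≤x∸g : g ≤ x ∸ g
    g≤x∸g = m+n≤o⇒m≤o∸n g g+g≤x
    x∸g≢F : x ∸ g ≢ F
    x∸g≢F x∸g≡F = x≢g+F (trans (sym (m+[n∸m]≡n g≤x)) (cong (g +_) x∸g≡F))

  Indecomposable⇒<g+g⊎≡g+F : ∀ {x} → Indecomposable S x → x < g + g ⊎ x ≡ g + F
  Indecomposable⇒<g+g⊎≡g+F {x} (x∈S , _ , ¬decomposable) with x <? g + g
  ... | yes x<g+g = inj₁ x<g+g
  ... | no x≮g+g with x ≟ g + F
  ...   | yes x≡g+F = inj₂ x≡g+F
  ...   | no x≢g+F = ⊥-elim (¬decomposable (Decomposable-≥g+g x∈S (≮⇒≥ x≮g+g) x≢g+F))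

  g+F-Decomposable : 3 ≤ n → Decomposable S (g + F)
  g+F-Decomposable 3≤n =
    suc g , F∸1 , S-intro (n≤1+n g) (<⇒≢ g+1<F) , S-intro (≤-pred g<F) (<⇒≢ (n<1+n F∸1)) ,
    s≤s z≤n , s≤s z≤n , sym (+-suc g F∸1)
    where
    F∸1 : ℕ
    F∸1 = suc (a + n)
    g+1<F : suc g < F
    g+1<F = s≤s (s≤s (subst (_≤ a + n) (+-comm a 3) (+-monoʳ-≤ a 3≤n)))

  g+F-Indecomposable : n ≡ 2 → Indecomposable S (g + F)
  g+F-Indecomposable n≡2 = S-intro (m≤m+n g F) (>⇒≢ (m<n+m F 0<g)) , s≤s z≤n , ¬decomposable
    where
    F≡1+g : F ≡ suc g
    F≡1+g = trans (cong (λ m → 2 + (a + m)) n≡2) (cong (2 +_) (+-comm a 2))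
    ¬decomposable : ¬ Decomposable S (g + F)
    ¬decomposable (b , y , b∈S , y∈S , 0<b , 0<y , b+y≡g+F) = F∉S (subst S y≡F y∈S)
      where
      g≤b : g ≤ b
      g≤b = nonzero⇒g≤ b∈S 0<b
      b≤F : b ≤ F
      b≤F = +-cancelʳ-≤ g b F (subst (b + g ≤_) (trans b+y≡g+F (+-comm g F)) (+-monoʳ-≤ b (nonzero⇒g≤ y∈S 0<y)))
      b≡g : b ≡ g
      b≡g = ≤-antisym (≤-pred (subst (b <_) F≡1+g (≤∧≢⇒< b≤F λ b≡F → F∉S (subst S b≡F b∈S)))) g≤b
      y≡F : y ≡ F
      y≡F = +-cancelˡ-≡ g y F (trans (cong (_+ y) (sym b≡g)) b+y≡g+F)

  trichotomous : Trichotomous S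
  trichotomous x x∈S with S-elim x∈S
  ... | inj₁ x≡0 = inj₁ x≡0
  ... | inj₂ g≤x with x <? g + g
  ...   | yes x<g+g = inj₂ (inj₁ (Indecomposable-<g+g x∈S (<-≤-trans 0<g g≤x) x<g+g))
  ...   | no x≮g+g with x ≟ g + F
  ...     | no x≢g+F = inj₂ (inj₂ (Decomposable-≥g+g x∈S (≮⇒≥ x≮g+g) x≢g+F))
  ...     | yes refl with m≤n⇒m<n∨m≡n 1≤k
  ...       | inj₁ 1<k = inj₂ (inj₂ (g+F-Decomposable (s≤s 1<k)))
  ...       | inj₂ 1≡k = inj₂ (inj₁ (g+F-Indecomposable (cong suc (sym 1≡k))))

  NonzeroBelow2g : Subset
  NonzeroBelow2g x = S x × 0 < x × x < g + g

  IsCard-NonzeroBelow2g : IsCard NonzeroBelow2g (g ∸ 1)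
  IsCard-NonzeroBelow2g = subst (IsCard NonzeroBelow2g) (m+[n∸m]≡n k≤g∸1)
    (IsCard-resp from to (IsCard-⊎ disjoint (IsCard-interval g k) (IsCard-interval (suc F) (g ∸ 1 ∸ k))))
    where
    k≤g∸1 : k ≤ g ∸ 1
    k≤g∸1 = ≤-pred n≤g
    end≡g+g : suc F + (g ∸ 1 ∸ k) ≡ g + g
    end≡g+g = begin
      (g + n) + (g ∸ 1 ∸ k)     ≡⟨ +-assoc g n _ ⟩
      g + suc (k + (g ∸ 1 ∸ k)) ≡⟨ cong (λ m → g + suc m) (m+[n∸m]≡n k≤g∸1) ⟩
      g + g                     ∎
      where open ≡-Reasoning
    Lower Upper : Subset
    Lower x = g ≤ x × x < g + k
    Upper x = suc F ≤ x × x < suc F + (g ∸ 1 ∸ k)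
    from : ∀ x → Lower x ⊎ Upper x → NonzeroBelow2g x
    from x (inj₁ (g≤x , x<g+k)) =
      let x<F = subst (x <_) g+k≡F x<g+k
      in S-intro g≤x (<⇒≢ x<F) , <-≤-trans 0<g g≤x , <-trans x<F F<g+g
    from x (inj₂ (F<x , x<end)) = inj₂ (inj₂ F<x) , <-≤-trans (s≤s z≤n) F<x , subst (x <_) end≡g+g x<end
    to : ∀ x → NonzeroBelow2g x → Lower x ⊎ Upper x
    to x (x∈S , 0<x , x<g+g) with <-cmp x F
    ... | tri< x<F _ _ = inj₁ (nonzero⇒g≤ x∈S 0<x , subst (x <_) (sym g+k≡F) x<F)
    ... | tri≈ _ refl _ = ⊥-elim (F∉S x∈S)
    ... | tri> _ _ F<x = inj₂ (F<x , subst (x <_) (sym end≡g+g) x<g+g)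
    disjoint : ∀ x → Lower x → ¬ Upper x
    disjoint x (_ , x<g+k) (F<x , _) = <-asym (subst (x <_) g+k≡F x<g+k) F<x

  embDim-3≤n : 3 ≤ n → HasEmbDim S (g ∸ 1)
  embDim-3≤n 3≤n = HasEmbDim-Indecomposable numericalSemigroup trichotomous
    (IsCard-resp (λ _ (x∈S , 0<x , x<g+g) → Indecomposable-<g+g x∈S 0<x x<g+g) to IsCard-NonzeroBelow2g)
    where
    to : ∀ x → Indecomposable S x → NonzeroBelow2g x
    to x ind@(x∈S , 0<x , ¬decomposable) with Indecomposable⇒<g+g⊎≡g+F ind
    ... | inj₁ x<g+g = x∈S , 0<x , x<g+g
    ... | inj₂ refl = ⊥-elim (¬decomposable (g+F-Decomposable 3≤n))

  embDim-n≡2 : n ≡ 2 → HasEmbDim S g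
  embDim-n≡2 n≡2 = HasEmbDim-Indecomposable numericalSemigroup trichotomous
    (subst (IsCard (Indecomposable S)) (+-comm (2 + a) 1)
      (IsCard-resp from to (IsCard-⊎ disjoint IsCard-NonzeroBelow2g (IsCard-singleton (g + F)))))
    where
    from : ∀ x → NonzeroBelow2g x ⊎ x ≡ g + F → Indecomposable S x
    from _ (inj₁ (x∈S , 0<x , x<g+g)) = Indecomposable-<g+g x∈S 0<x x<g+g
    from _ (inj₂ refl) = g+F-Indecomposable n≡2
    to : ∀ x → Indecomposable S x → NonzeroBelow2g x ⊎ x ≡ g + F
    to x ind@(x∈S , 0<x , _) with Indecomposable⇒<g+g⊎≡g+F ind
    ... | inj₁ x<g+g = inj₁ (x∈S , 0<x , x<g+g)
    ... | inj₂ x≡g+F = inj₂ x≡g+F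
    disjoint : ∀ x → NonzeroBelow2g x → x ≢ g + F
    disjoint _ (_ , _ , x<g+g) refl = <⇒≱ x<g+g (+-monoʳ-≤ g (<⇒≤ g<F))

proposition3p2 : (g n : ℕ) → 2 < g → 2 ≤ n → n ≤ g →
    NumericalSemigroup (Sgn g n) × Special (Sgn g n)
    × IsFrobenius (Sgn g n) (g + n ∸ 1) × HasGenus (Sgn g n) g × HasN (Sgn g n) n
    × ((n ≡ g ⊎ n ≡ g ∸ 1) → Irreducible (Sgn g n))
    × (3 ≤ n → n < g ∸ 1 → ¬ Irreducible (Sgn g n) × HasEmbDim (Sgn g n) (g ∸ 1))
    × (3 < g → n ≡ 2 → ¬ Irreducible (Sgn g n) × HasEmbDim (Sgn g n) g)
proposition3p2 (suc (suc (suc a))) (suc k) (s≤s (s≤s (s≤s z≤n))) (s≤s 1≤k) n≤g =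
  numericalSemigroup , special , isFrobenius , genus , hasN , irreducible ,
  (λ 3≤n n<g∸1 → ¬irreducible n<g∸1 , embDim-3≤n 3≤n) ,
  (λ 3<g n≡2 → ¬irreducible (subst (_< 2 + a) (sym n≡2) (≤-pred 3<g)) , embDim-n≡2 n≡2)
  where open Sgn-structure a k 1≤k n≤g
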